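{- For any finite undirected graph $G=(V,E)$, the minimum over all hierarchical Customizable Hub Labelings $L$ of $G$ of the average label size $\frac{1}{|V|}\sum_{v\in V}|L(v)|$ equals the minimum over all vertex orders $\pi$ of the average CCH search space size $\frac{1}{|V|}\sum_{v\in V}|\mathit{SS}_\pi(v)|$; and the minimum over all HCuHL of the maximum label size $\max_{v}|L(v)|$ equals the minimum over all vertex orders $\pi$ of the maximum search space size $\max_v|\mathit{SS}_\pi(v)|$.
   Context: A labeling is a function $L\colon V\to 2^V$. A Customizable Hub Labeling (CuHL) satisfies: for any $s,t\in V$ and any $s$-$t$-path $P$ in $G$, $L(s)\cap L(t)$ contains a vertex of $P$. It is hierarchical (HCuHL) if there is a bijective order $\pi\colon V\to\{1,\dots,|V|\}$ with $u\in L(v)\Rightarrow \pi(u)\ge\pi(v)$. For an order $\pi$, the CCH graph $G^*$ adds to $G$ an edge $\{v,w\}$ whenever there is a simple $v$-$w$-path in $G$ whose interior vertices $u$ all satisfy $\pi(u)<\min\{\pi(v),\pi(w)\}$; $\mathit{SS}_\pi(v)$ is the set of vertices reachable from $v$ in $G^*$ via a path with increasing ranks (including $v$). -}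

module Defs where

open import Data.Nat using (ℕ; zero; suc; _+_; _⊔_; _≤_; _<_; _≥_)
open import Data.Fin using (Fin; toℕ) renaming (zero to fzero; suc to fsuc)
open import Data.Fin.Subset using (Subset; _∈_; ∣_∣)
open import Data.Fin.Permutation using (Permutation′; _⟨$⟩ʳ_)
open import Data.List using (List; []; _∷_; _++_)
open import Data.List.Relation.Unary.All using (All)
open import Data.List.Relation.Unary.Any using (Any)
open import Data.List.Relation.Unary.Unique.Propositional using (Unique)
open import Data.Product using (Σ; Σ-syntax; ∃; _×_; _,_)
open import Data.Bool using (Bool; true; false; T)
open import Function.Bundles using (_⇔_)
open import Relation.Binary.PropositionalEquality using (_≡_; _≢_)
open import Relation.Nullary using (¬_)

record Graph : Set where
  field
    n      : ℕ
    adj    : Fin n → Fin n → Bool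
    sym    : ∀ u v → adj u v ≡ adj v u
    irrefl : ∀ v → adj v v ≡ false
open Graph public

Vertex : Graph → Set
Vertex G = Fin (n G)

Edge : (G : Graph) → Vertex G → Vertex G → Set
Edge G u v = T (adj G u v)

data Chain (G : Graph) : Vertex G → List (Vertex G) → Set where
  single : ∀ {x} → Chain G x []
  step   : ∀ {x y ys} → Edge G x y → Chain G y ys → Chain G x (y ∷ ys)

data Path (G : Graph) (s t : Vertex G) : List (Vertex G) → Set where
  trivial : s ≡ t → Path G s t (s ∷ [])
  nontriv : (interior : List (Vertex G)) →
            Chain G s (interior ++ (t ∷ [])) →
            Path G s t (s ∷ interior ++ (t ∷ []))

Labeling : Graph → Set
Labeling G = Vertex G → Subset (n G)

IsCuHL : (G : Graph) → Labeling G → Set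
IsCuHL G L = ∀ s t (vs : List (Vertex G)) → Path G s t vs →
             Any (λ u → u ∈ L s × u ∈ L t) vs

-- Vertex orders: bijections V → {0,…,|V|-1} (ranks start at 0 instead of 1).
Order : Graph → Set
Order G = Permutation′ (n G)

rank : {G : Graph} → Order G → Vertex G → ℕ
rank π v = toℕ (π ⟨$⟩ʳ v)

IsHCuHL : (G : Graph) → Labeling G → Set
IsHCuHL G L = IsCuHL G L ×
  (Σ[ π ∈ Order G ] (∀ u v → u ∈ L v → rank {G} π u ≥ rank {G} π v))

CCHEdge : (G : Graph) → Order G → Vertex G → Vertex G → Set
CCHEdge G π v w =
  v ≢ w ×
  Σ[ interior ∈ List (Vertex G) ]
    ( Chain G v (interior ++ (w ∷ []))
    × Unique (v ∷ interior ++ (w ∷ []))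
    × All (λ u → rank {G} π u < rank {G} π v × rank {G} π u < rank {G} π w) interior )

data SS (G : Graph) (π : Order G) (v : Vertex G) : Vertex G → Set where
  here  : SS G π v v
  there : ∀ {u w} → SS G π v u → CCHEdge G π u w →
          rank {G} π u < rank {G} π w → SS G π v w

HasSize : {m : ℕ} → (Fin m → Set) → ℕ → Set
HasSize {m} P k = Σ[ S ∈ Subset m ] ((∀ u → (u ∈ S) ⇔ P u) × ∣ S ∣ ≡ k)

-- Sum and maximum of a function over Fin m (maximum of nothing is 0).
sumF : {m : ℕ} → (Fin m → ℕ) → ℕ
sumF {zero}  f = 0
sumF {suc m} f = f fzero + sumF (λ i → f (fsuc i))

maxF : {m : ℕ} → (Fin m → ℕ) → ℕ
maxF {zero}  f = 0
maxF {suc m} f = f fzero ⊔ maxF (λ i → f (fsuc i))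

SSSizes : (G : Graph) → Order G → (Vertex G → ℕ) → Set
SSSizes G π k = ∀ v → HasSize (SS G π v) (k v)

IsMinLabelCost : (G : Graph) → ((Vertex G → ℕ) → ℕ) → ℕ → Set
IsMinLabelCost G agg m =
  (Σ[ L ∈ Labeling G ] (IsHCuHL G L × agg (λ v → ∣ L v ∣) ≡ m)) ×
  (∀ L → IsHCuHL G L → m ≤ agg (λ v → ∣ L v ∣))

IsMinSSCost : (G : Graph) → ((Vertex G → ℕ) → ℕ) → ℕ → Set
IsMinSSCost G agg m =
  (Σ[ π ∈ Order G ] Σ[ k ∈ (Vertex G → ℕ) ] (SSSizes G π k × agg k ≡ m)) ×
  (∀ π k → SSSizes G π k → m ≤ agg k)

-- Fix an order π and write r for its ranks. A vertex u lies in SS_π(v) iff u can be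
-- reached from v by a walk all of whose vertices have rank at most r(u).  Hence SS_π is
-- itself a hierarchical CuHL: the highest vertex of an s-t path is in SS_π(s) ∩ SS_π(t).
-- Conversely every HCuHL L for π has SS_π(v) ⊆ L(v): for u ∈ SS_π(v) there is a v-u path
-- on which every vertex other than u ranks below u, and a common hub of v and u on it
-- must rank at least r(u), so it is u itself.  Thus for a monotone aggregate (sum or max)
-- the best label cost equals the best search-space cost, and the latter is attained
-- because there are only finitely many orders.

module Submission where

open import Defs
open import Data.Bool using (T; true)
open import Data.Empty using (⊥-elim)
open import Data.Fin using (Fin; toℕ; _≟_; punchIn) renaming (zero to fzero; suc to fsuc; _<_ to _<ᶠ_)
open import Data.Fin.Permutation
  using (Permutation′; _⟨$⟩ʳ_; _⟨$⟩ˡ_; _≈_; inverseˡ; insert; remove; insert-remove)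
  renaming (id to idₚ)
open import Data.Fin.Properties using (any?; pigeonhole; toℕ-injective)
open import Data.Fin.Subset using (Subset; _∈_; ∣_∣)
open import Data.Fin.Subset.Properties using (⊆-antisym; p⊆q⇒∣p∣≤∣q∣)
open import Data.List using (List; []; _∷_; _++_; _∷ʳ_; length; lookup; allFin; cartesianProductWith; initLast; _∷ʳ′_)
open import Data.List.Extrema.Nat using (argmin; argmax; argmax-sel; f[argmin]≤f[xs]; f[⊥]≤f[argmax]; f[xs]≤f[argmax])
open import Data.List.Membership.Propositional renaming (_∈_ to _∈ₗ_)
open import Data.List.Membership.Propositional.Properties using (∈-lookup; ∈-allFin; ∈-cartesianProductWith⁺)
open import Data.List.Properties using (++-assoc)
open import Data.List.Relation.Binary.Permutation.Propositional using (↭-sym)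
open import Data.List.Relation.Binary.Permutation.Propositional.Properties using (∷↭∷ʳ)
open import Data.List.Relation.Binary.Subset.Propositional renaming (_⊆_ to _⊆ₗ_)
open import Data.List.Relation.Binary.Subset.Propositional.Properties using (⊆-refl; ⊆-trans; ⊆-reflexive-↭; ∷⁺ʳ; xs⊆x∷xs; ++⁺ˡ)
open import Data.List.Relation.Unary.All as All using (All; []; _∷_)
import Data.List.Relation.Unary.All.Properties as All
open import Data.List.Relation.Unary.AllPairs as AllPairs using ([]; _∷_)
open import Data.List.Relation.Unary.Any as Any using (here; there)
import Data.List.Relation.Unary.Any.Properties as Any
open import Data.List.Relation.Unary.Unique.Propositional using (Unique)
open import Data.Nat using (ℕ; zero; suc; _≤_; _<_; _≥_; z≤n; s≤s; s≤s⁻¹; _≤?_; _<?_)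
open import Data.Nat.Properties
  using (≤-refl; ≤-trans; ≤-reflexive; ≤-antisym; <-trans; <-irrefl; <⇒≤; <⇒≱; ≮⇒≥; ≰⇒>; ≤∧≢⇒<; n≤1+n; +-mono-≤; ⊔-mono-≤)
open import Data.Product using (∃; ∃₂; _×_; _,_; proj₁; proj₂)
open import Data.Sum using (_⊎_; inj₁; inj₂)
import Data.Vec
open import Data.Vec using (tabulate)
open import Data.Vec.Properties using (lookup∘tabulate; []=⇒lookup; lookup⇒[]=)
open import Function using (_∘_)
open import Function.Bundles using (_⇔_; mk⇔; Equivalence)
open import Function.Construct.Symmetry using (⇔-sym)
open import Level using (0ℓ)
open import Relation.Binary.Core using (Rel)
open import Relation.Binary.Definitions using (Decidable)
open import Relation.Binary.PropositionalEquality using (_≡_; _≢_; refl; trans; cong; subst; subst₂) renaming (sym to ≡-sym)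
open import Relation.Nullary using (does)
import Relation.Nullary.Decidable as Dec
open import Relation.Nullary.Decidable using (_×-dec_; _⊎-dec_; T?)
open import Relation.Unary using (Pred)
import Relation.Unary as U

private variable
  m : ℕ

Unique-lookup-distinct : ∀ {A : Set} {xs : List A} → Unique xs →
                         ∀ {i j} → i <ᶠ j → lookup xs i ≢ lookup xs j
Unique-lookup-distinct {xs = _ ∷ _} (x∉xs ∷ _)  {fzero}  {fsuc j} _   = All.lookup x∉xs (∈-lookup j)
Unique-lookup-distinct {xs = _ ∷ _} (_ ∷ unique) {fsuc i} {fsuc j} i<j =
  Unique-lookup-distinct unique (s≤s⁻¹ i<j)

Unique⇒length≤ : {xs : List (Fin m)} → Unique xs → length xs ≤ m
Unique⇒length≤ {m} {xs} unique with length xs ≤? m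
... | Dec.yes le = le
... | Dec.no  gt with pigeonhole (≰⇒> gt) (lookup xs)
...   | i , j , i<j , same = ⊥-elim (Unique-lookup-distinct unique i<j same)

toSubset : {P : Pred (Fin m) 0ℓ} → U.Decidable P → Subset m
toSubset P? = tabulate (does ∘ P?)

∈-toSubset : {P : Pred (Fin m) 0ℓ} (P? : U.Decidable P) {u : Fin m} → u ∈ toSubset P? ⇔ P u
∈-toSubset {P = P} P? {u} = mk⇔ (true⇒P ∘ []=⇒lookup) (lookup⇒[]= u _ ∘ P⇒true)
  where
  true⇒P : Data.Vec.lookup (toSubset P?) u ≡ true → P u
  true⇒P eq with P? u | trans (≡-sym (lookup∘tabulate (does ∘ P?) u)) eq
  ... | Dec.yes Pu | _ = Pu
  ... | Dec.no _   | ()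

  P⇒true : P u → Data.Vec.lookup (toSubset P?) u ≡ true
  P⇒true Pu = trans (lookup∘tabulate (does ∘ P?) u) (Dec.dec-true (P? u) Pu)

HasSize⇒∣∣≡ : {P : Pred (Fin m) 0ℓ} {S : Subset m} {k : ℕ} →
              (∀ u → u ∈ S ⇔ P u) → HasSize P k → ∣ S ∣ ≡ k
HasSize⇒∣∣≡ {S = S} S⇔P (S′ , S′⇔P , ∣S′∣≡k) = trans (cong ∣_∣ S≡S′) ∣S′∣≡k
  where
  open Equivalence
  S≡S′ : S ≡ S′
  S≡S′ = ⊆-antisym (λ u∈S → from (S′⇔P _) (to (S⇔P _) u∈S)) (λ u∈S′ → from (S⇔P _) (to (S′⇔P _) u∈S′))

infixr 5 _◅_

data Walk (R : Rel (Fin m) 0ℓ) : Fin m → Fin m → List (Fin m) → Set where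
  ε   : ∀ {a} → Walk R a a []
  _◅_ : ∀ {a y b ys} → R a y → Walk R y b ys → Walk R a b (y ∷ ys)

Reachable : Rel (Fin m) 0ℓ → Rel (Fin m) 0ℓ
Reachable R a b = ∃ λ xs → Walk R a b xs

module _ {R : Rel (Fin m) 0ℓ} where

  _▻_ : ∀ {a b c xs} → Walk R a b xs → R b c → Walk R a c (xs ∷ʳ c)
  ε       ▻ r = r ◅ ε
  (s ◅ w) ▻ r = s ◅ (w ▻ r)

  Walk-restrict : ∀ {Q : Pred (Fin m) 0ℓ} {a b xs} →
                  Walk R a b xs → All Q xs → Walk (λ x y → R x y × Q y) a b xs
  Walk-restrict ε       []         = ε
  Walk-restrict (r ◅ w) (qy ∷ qys) = (r , qy) ◅ Walk-restrict w qys

  Walk-last : ∀ {a b z} xs → Walk R a b (xs ∷ʳ z) → z ≡ b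
  Walk-last []      (_ ◅ ε) = refl
  Walk-last (_ ∷ xs) (_ ◅ w) = Walk-last xs w

  Walk-sources : ∀ {Q : Pred (Fin m) 0ℓ} {a b z} → (∀ {x y} → R x y → Q x) →
                 ∀ xs → Walk R a b (xs ∷ʳ z) → All Q (a ∷ xs)
  Walk-sources source []       (r ◅ _) = source r ∷ []
  Walk-sources source (_ ∷ xs) (r ◅ w) = source r ∷ Walk-sources source xs w

  splitAt : ∀ {a b c xs} → Walk R a b xs → c ∈ₗ (a ∷ xs) →
            ∃₂ λ p q → Walk R a c p × Walk R c b q × (a ∷ p) ⊆ₗ (a ∷ xs) × (c ∷ q) ⊆ₗ (a ∷ xs)
  splitAt {a} w (here refl) = [] , _ , ε , w , ∷⁺ʳ a (λ ()) , ⊆-refl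
  splitAt {a} (_◅_ {y = y} r w) (there c∈) with splitAt w c∈
  ... | p , q , w₁ , w₂ , p⊆ , q⊆ = y ∷ p , q , r ◅ w₁ , w₂ , ∷⁺ʳ a p⊆ , ⊆-trans q⊆ (xs⊆x∷xs _ a)

  reverse : (∀ {x y} → R x y → R y x) → ∀ {a b xs} → Walk R a b xs →
            ∃ λ ys → Walk R b a ys × (b ∷ ys) ⊆ₗ (a ∷ xs)
  reverse R-sym ε = [] , ε , ⊆-refl
  reverse R-sym {a} (_◅_ {y = y} {ys = xs} r w) with reverse R-sym w
  ... | ys , w′ , ys⊆ = ys ∷ʳ a , w′ ▻ R-sym r ,
                        ⊆-trans (++⁺ˡ _ ys⊆) (⊆-reflexive-↭ (↭-sym (∷↭∷ʳ a (y ∷ xs))))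

  dropUntil : ∀ {a b c xs} → Walk R a b xs → Unique (a ∷ xs) → c ∈ₗ (a ∷ xs) →
              ∃ λ q → Walk R c b q × Unique (c ∷ q) × q ⊆ₗ xs
  dropUntil w       unique        (here refl) = _ , w , unique , ⊆-refl
  dropUntil (_ ◅ w) (_ ∷ unique) (there c∈) with dropUntil w unique c∈
  ... | q , w′ , unique′ , q⊆ = q , w′ , unique′ , there ∘ q⊆

  simplify : ∀ {a b xs} → Walk R a b xs → ∃ λ ys → Walk R a b ys × Unique (a ∷ ys) × ys ⊆ₗ xs
  simplify ε = [] , ε , [] ∷ [] , ⊆-refl
  simplify {a} (_◅_ {y = y} r w) with simplify w
  ... | ys , w′ , unique , ys⊆ with Any.any? (a ≟_) (y ∷ ys)
  ...   | Dec.yes a∈ = let q , w″ , unique′ , q⊆ = dropUntil w′ unique a∈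
                       in q , w″ , unique′ , there ∘ ys⊆ ∘ q⊆
  ...   | Dec.no  a∉ = y ∷ ys , r ◅ w′ , All.¬Any⇒All¬ _ a∉ ∷ unique , ∷⁺ʳ y ys⊆

  ReachableWithin : ℕ → Rel (Fin m) 0ℓ
  ReachableWithin k a b = ∃ λ xs → Walk R a b xs × length xs ≤ k

  ReachableWithin-suc⇔ : ∀ {k a b} →
    (a ≡ b ⊎ ∃ λ y → R a y × ReachableWithin k y b) ⇔ ReachableWithin (suc k) a b
  ReachableWithin-suc⇔ = mk⇔
    (λ { (inj₁ refl) → [] , ε , z≤n ; (inj₂ (y , r , xs , w , ≤k)) → y ∷ xs , r ◅ w , s≤s ≤k })
    (λ { ([] , ε , _) → inj₁ refl ; (y ∷ xs , r ◅ w , ≤k) → inj₂ (y , r , xs , w , s≤s⁻¹ ≤k) })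

  reachableWithin? : Decidable R → ∀ k → Decidable (ReachableWithin k)
  reachableWithin? R? zero    a b = Dec.map (mk⇔ (λ { refl → [] , ε , z≤n }) (λ { ([] , ε , _) → refl })) (a ≟ b)
  reachableWithin? R? (suc k) a b =
    Dec.map ReachableWithin-suc⇔ (a ≟ b ⊎-dec any? (λ y → R? a y ×-dec reachableWithin? R? k y b))

  reachable? : Decidable R → Decidable (Reachable R)
  reachable? R? a b = Dec.map (mk⇔ (λ (xs , w , _) → xs , w) shorten) (reachableWithin? R? m a b)
    where
    shorten : Reachable R a b → ReachableWithin m a b
    shorten (_ , w) with simplify w
    ... | ys , w′ , unique , _ = ys , w′ , ≤-trans (n≤1+n _) (Unique⇒length≤ unique)

module _ (G : Graph) where

  private
    V : Set
    V = Vertex G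

  Edge-sym : ∀ {x y} → Edge G x y → Edge G y x
  Edge-sym {x} {y} = subst T (sym G x y)

  Chain⇒Walk : ∀ {a b} xs → Chain G a (xs ∷ʳ b) → Walk (Edge G) a b (xs ∷ʳ b)
  Chain⇒Walk []       (step e single) = e ◅ ε
  Chain⇒Walk (_ ∷ xs) (step e c)      = e ◅ Chain⇒Walk xs c

  Walk⇒Chain : ∀ {R : Rel V 0ℓ} {a b xs} → (∀ {x y} → R x y → Edge G x y) → Walk R a b xs → Chain G a xs
  Walk⇒Chain edge ε       = single
  Walk⇒Chain edge (r ◅ w) = step (edge r) (Walk⇒Chain edge w)

  Chain-++ : ∀ {a b} xs {ys} → Chain G a (xs ∷ʳ b) → Chain G b ys → Chain G a (xs ++ b ∷ ys)
  Chain-++ []       (step e single) c = step e c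
  Chain-++ (_ ∷ xs) (step e c₁)     c = step e (Chain-++ xs c₁ c)

  Path⇒Walk : ∀ {s t vs} → Path G s t vs → ∃ λ xs → vs ≡ s ∷ xs × Walk (Edge G) s t xs
  Path⇒Walk (trivial refl)       = [] , refl , ε
  Path⇒Walk (nontriv interior c) = interior ∷ʳ _ , refl , Chain⇒Walk interior c

module _ (G : Graph) (π : Order G) where

  private
    V : Set
    V = Vertex G

    r : V → ℕ
    r = rank {G} π

  rank-injective : ∀ {u v} → r u ≡ r v → u ≡ v
  rank-injective eq = trans (≡-sym (inverseˡ π)) (trans (cong (π ⟨$⟩ˡ_) (toℕ-injective eq)) (inverseˡ π))

  EdgeFrom≤ EdgeTo≤ : ℕ → Rel V 0ℓ
  EdgeFrom≤ t x y = Edge G x y × r x ≤ t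
  EdgeTo≤   t x y = Edge G x y × r y ≤ t

  CCHEdge-fromWalk : ∀ {v w xs} → r v < r w → Walk (EdgeFrom≤ (r v)) v w xs → CCHEdge G π v w
  CCHEdge-fromWalk {v} {w} v<w walk with simplify walk
  ... | ys , walk′ , unique , _ with initLast ys
  ...   | [] with ε ← walk′ = ⊥-elim (<-irrefl refl v<w)
  ...   | interior ∷ʳ′ _ with refl ← Walk-last interior walk′ =
      (λ { refl → <-irrefl refl v<w }) , interior , Walk⇒Chain G proj₁ walk′ , unique ,
      All.zipWith below (All.++⁻ˡ interior (AllPairs.head unique) , All.tail (Walk-sources proj₂ interior walk′))
    where
    below : ∀ {u} → v ≢ u × r u ≤ r v → r u < r v × r u < r w
    below (v≢u , u≤v) = let u<v = ≤∧≢⇒< u≤v (v≢u ∘ ≡-sym ∘ rank-injective) in u<v , <-trans u<v v<w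

  -- Invariant: v is the highest vertex met so far and the walk since v stays weakly below
  -- it, so the detour from v to the next vertex above it yields a CCH edge.
  private
    climb : ∀ {s v x b ps xs} → SS G π s v → Walk (EdgeFrom≤ (r v)) v x ps → r x ≤ r v → r v ≤ r b →
            Walk (EdgeTo≤ (r b)) x b xs → SS G π s b
    climb s↝v _ x≤v v≤b ε = subst (SS G π _) (rank-injective (≤-antisym v≤b x≤v)) s↝v
    climb {v = v} s↝v v⋯x x≤v v≤b (_◅_ {y = y} (e , y≤b) w) with r v <? r y
    ... | Dec.yes v<y = climb (there s↝v (CCHEdge-fromWalk v<y (v⋯x ▻ (e , x≤v))) v<y) ε ≤-refl y≤b w
    ... | Dec.no  v≮y = climb s↝v (v⋯x ▻ (e , x≤v)) (≮⇒≥ v≮y) v≤b w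

  SS⇒pathBelow : ∀ {v w} → SS G π v w →
                 v ≡ w ⊎ ∃ λ zs → Chain G v (zs ∷ʳ w) × All (λ u → r u < r w) (v ∷ zs)
  SS⇒pathBelow here = inj₁ refl
  SS⇒pathBelow (there v↝u (_ , interior , c , _ , lows) u<w) with SS⇒pathBelow v↝u
  ... | inj₁ refl = inj₂ (interior , c , u<w ∷ All.map proj₂ lows)
  ... | inj₂ (zs , c₁ , v<u ∷ zs<u) =
    inj₂ (zs ++ _ ∷ interior ,
          subst (Chain G _) (≡-sym (++-assoc zs (_ ∷ interior) (_ ∷ []))) (Chain-++ G zs c₁ c) ,
          <-trans v<u u<w ∷ All.++⁺ (All.map (λ z<u → <-trans z<u u<w) zs<u) (u<w ∷ All.map proj₂ lows))

  SS⇔reachableBelow : ∀ {v u} → SS G π v u ⇔ (r v ≤ r u × Reachable (EdgeTo≤ (r u)) v u)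
  SS⇔reachableBelow = mk⇔ to (λ (v≤u , _ , w) → climb here ε ≤-refl v≤u w)
    where
    to : ∀ {v u} → SS G π v u → r v ≤ r u × Reachable (EdgeTo≤ (r u)) v u
    to v↝u with SS⇒pathBelow v↝u
    ... | inj₁ refl = ≤-refl , [] , ε
    ... | inj₂ (zs , c , v<u ∷ zs<u) =
      <⇒≤ v<u , _ , Walk-restrict (Chain⇒Walk G zs c) (All.∷ʳ⁺ (All.map <⇒≤ zs<u) ≤-refl)

  SS? : ∀ v → U.Decidable (SS G π v)
  SS? v u = Dec.map (⇔-sym SS⇔reachableBelow) (r v ≤? r u ×-dec reachable? EdgeTo≤? v u)
    where
    EdgeTo≤? : Decidable (EdgeTo≤ (r u))
    EdgeTo≤? x y = T? (adj G x y) ×-dec r y ≤? r u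

  searchSpace : Labeling G
  searchSpace v = toSubset (SS? v)

  ∈-searchSpace : ∀ {v u} → u ∈ searchSpace v ⇔ SS G π v u
  ∈-searchSpace {v} = ∈-toSubset (SS? v)

  boundedWalk⇒SS : ∀ {a b xs} → Walk (Edge G) a b xs → All (λ z → r z ≤ r b) (a ∷ xs) → SS G π a b
  boundedWalk⇒SS w (a≤b ∷ xs≤b) = Equivalence.from SS⇔reachableBelow (a≤b , _ , Walk-restrict w xs≤b)

  searchSpace-isCuHL : IsCuHL G searchSpace
  searchSpace-isCuHL s t _ path with Path⇒Walk G path
  ... | xs , refl , walk = Any.map (λ { refl → top∈both }) top∈
    where
    top : V
    top = argmax r s xs

    top∈ : top ∈ₗ (s ∷ xs)
    top∈ with argmax-sel r s xs
    ... | inj₁ top≡s  = here top≡s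
    ... | inj₂ top∈xs = there top∈xs

    below-top : All (λ z → r z ≤ r top) (s ∷ xs)
    below-top = f[⊥]≤f[argmax] {f = r} s xs ∷ f[xs]≤f[argmax] {f = r} s xs

    top∈both : top ∈ searchSpace s × top ∈ searchSpace t
    top∈both with splitAt walk top∈
    ... | _ , _ , s⋯top , top⋯t , p⊆ , q⊆ with reverse (Edge-sym G) top⋯t
    ... | _ , t⋯top , ys⊆ =
      Equivalence.from ∈-searchSpace (boundedWalk⇒SS s⋯top (All.anti-mono p⊆ below-top)) ,
      Equivalence.from ∈-searchSpace (boundedWalk⇒SS t⋯top (All.anti-mono (⊆-trans ys⊆ q⊆) below-top))

  searchSpace-isHCuHL : IsHCuHL G searchSpace
  searchSpace-isHCuHL = searchSpace-isCuHL , π , λ u v u∈ →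
    proj₁ (Equivalence.to SS⇔reachableBelow (Equivalence.to ∈-searchSpace u∈))

  SS⊆label : ∀ {L} → IsCuHL G L → (∀ u v → u ∈ L v → r u ≥ r v) → ∀ {v w} → SS G π v w → w ∈ L v
  SS⊆label cuhl hier {v} {w} v↝w with SS⇒pathBelow v↝w
  ... | inj₁ refl with cuhl v v _ (trivial refl)
  ...   | here (v∈Lv , _) = v∈Lv
  SS⊆label cuhl hier {v} {w} v↝w | inj₂ (zs , c , below) with Any.++⁻ (v ∷ zs) (cuhl v w _ (nontriv zs c))
  ... | inj₁ hub∈ = let u<w , _ , u∈Lw = All.lookupAny below hub∈ in ⊥-elim (<⇒≱ u<w (hier _ w u∈Lw))
  ... | inj₂ hub∈ = proj₁ (Any.singleton⁻ hub∈)

module _ (G : Graph) {π ρ : Order G} (π≈ρ : π ≈ ρ) where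

  private
    rank-≡ : ∀ x → rank {G} π x ≡ rank {G} ρ x
    rank-≡ x = cong toℕ (π≈ρ x)

    transport-< : ∀ {x y} → rank {G} π x < rank {G} π y → rank {G} ρ x < rank {G} ρ y
    transport-< {x} {y} = subst₂ _<_ (rank-≡ x) (rank-≡ y)

  CCHEdge-resp-≈ : ∀ {v w} → CCHEdge G π v w → CCHEdge G ρ v w
  CCHEdge-resp-≈ (v≢w , interior , c , unique , lows) =
    v≢w , interior , c , unique , All.map (λ (x<v , x<w) → transport-< x<v , transport-< x<w) lows

  SS-resp-≈ : ∀ {v w} → SS G π v w → SS G ρ v w
  SS-resp-≈ here              = here
  SS-resp-≈ (there v↝u e u<w) = there (SS-resp-≈ v↝u) (CCHEdge-resp-≈ e) (transport-< u<w)

∣searchSpace∣-resp-≈ : ∀ G {π ρ : Order G} → π ≈ ρ → ∀ v → ∣ searchSpace G π v ∣ ≡ ∣ searchSpace G ρ v ∣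
∣searchSpace∣-resp-≈ G {π} {ρ} π≈ρ v = cong ∣_∣ (⊆-antisym
  (from (∈-searchSpace G ρ) ∘ SS-resp-≈ G π≈ρ ∘ to (∈-searchSpace G π))
  (from (∈-searchSpace G π) ∘ SS-resp-≈ G (≡-sym ∘ π≈ρ) ∘ to (∈-searchSpace G ρ)))
  where open Equivalence

insert-cong : ∀ (i j : Fin (suc m)) {ρ σ : Permutation′ m} → ρ ≈ σ → insert i j ρ ≈ insert i j σ
insert-cong i j ρ≈σ k with i ≟ k
... | Dec.yes _ = refl
... | Dec.no  _ = cong (punchIn j) (ρ≈σ _)

allPermutations : ∀ m → List (Permutation′ m)
allPermutations zero    = idₚ ∷ []
allPermutations (suc m) = cartesianProductWith (insert fzero) (allFin (suc m)) (allPermutations m)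

allPermutations-complete : ∀ m (π : Permutation′ m) → ∃ λ ρ → ρ ∈ₗ allPermutations m × ρ ≈ π
allPermutations-complete zero    π = idₚ , here refl , λ ()
allPermutations-complete (suc m) π with allPermutations-complete m (remove fzero π)
... | ρ , ρ∈ , ρ≈ = insert fzero (π ⟨$⟩ʳ fzero) ρ ,
                    ∈-cartesianProductWith⁺ (insert fzero) (∈-allFin _) ρ∈ ,
                    λ i → trans (insert-cong fzero _ ρ≈ i) (insert-remove fzero π i)

∃-minimal-permutation : (f : Permutation′ m → ℕ) → (∀ {ρ σ} → ρ ≈ σ → f ρ ≤ f σ) →
                        ∃ λ π₀ → ∀ π → f π₀ ≤ f π
∃-minimal-permutation {m} f f-resp = argmin f idₚ (allPermutations m) , minimal
  where
  minimal : ∀ π → f (argmin f idₚ (allPermutations m)) ≤ f π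
  minimal π with allPermutations-complete m π
  ... | ρ , ρ∈ , ρ≈π = ≤-trans (All.lookup (f[argmin]≤f[xs] idₚ (allPermutations m)) ρ∈) (f-resp ρ≈π)

sumF-mono : {f g : Fin m → ℕ} → (∀ i → f i ≤ g i) → sumF f ≤ sumF g
sumF-mono {zero}  _   = z≤n
sumF-mono {suc m} f≤g = +-mono-≤ (f≤g fzero) (sumF-mono (f≤g ∘ fsuc))

maxF-mono : {f g : Fin m → ℕ} → (∀ i → f i ≤ g i) → maxF f ≤ maxF g
maxF-mono {zero}  _   = z≤n
maxF-mono {suc m} f≤g = ⊔-mono-≤ (f≤g fzero) (maxF-mono (f≤g ∘ fsuc))

module _ (G : Graph) (agg : (Vertex G → ℕ) → ℕ) (agg-mono : ∀ {f g} → (∀ v → f v ≤ g v) → agg f ≤ agg g) where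

  searchSpaceCost : Order G → ℕ
  searchSpaceCost π = agg (λ v → ∣ searchSpace G π v ∣)

  searchSpace-sizes : ∀ π → SSSizes G π (λ v → ∣ searchSpace G π v ∣)
  searchSpace-sizes π v = searchSpace G π v , (λ _ → ∈-searchSpace G π) , refl

  labelCost≥searchSpaceCost : ∀ {L} → IsHCuHL G L → ∃ λ π → searchSpaceCost π ≤ agg (λ v → ∣ L v ∣)
  labelCost≥searchSpaceCost (cuhl , π , hier) =
    π , agg-mono (λ v → p⊆q⇒∣p∣≤∣q∣ (SS⊆label G π cuhl hier ∘ Equivalence.to (∈-searchSpace G π)))

  searchSpaceCost≤sizes : ∀ π {k} → SSSizes G π k → searchSpaceCost π ≤ agg k
  searchSpaceCost≤sizes π sizes = agg-mono (λ v → ≤-reflexive (HasSize⇒∣∣≡ (λ _ → ∈-searchSpace G π) (sizes v)))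

  minLabelCost≡minSSCost : ∃ λ c → IsMinLabelCost G agg c × IsMinSSCost G agg c
  minLabelCost≡minSSCost with ∃-minimal-permutation searchSpaceCost
                                (λ {π} {ρ} π≈ρ → agg-mono (λ v → ≤-reflexive (∣searchSpace∣-resp-≈ G {π} {ρ} π≈ρ v)))
  ... | π₀ , π₀-minimal =
    searchSpaceCost π₀ ,
    ((searchSpace G π₀ , searchSpace-isHCuHL G π₀ , refl) ,
     λ L hcuhl → let π , π≤L = labelCost≥searchSpaceCost hcuhl in ≤-trans (π₀-minimal π) π≤L) ,
    ((π₀ , _ , searchSpace-sizes π₀ , refl) ,
     λ π k sizes → ≤-trans (π₀-minimal π) (searchSpaceCost≤sizes π sizes))

mainTheorem4 : (G : Graph) →
    (∃ λ (m : ℕ) → IsMinLabelCost G sumF m × IsMinSSCost G sumF m) ×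
    (∃ λ (m : ℕ) → IsMinLabelCost G maxF m × IsMinSSCost G maxF m)
mainTheorem4 G = minLabelCost≡minSSCost G sumF sumF-mono , minLabelCost≡minSSCost G maxF maxF-mono
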